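{- Let $m,n\geq 0$ and $\mathbf{u},\mathbf{v}\in\mathsf{Shuf}(m,n)$. Then $\mathbf{u}\leq_{\mathsf{bub}}\mathbf{v}$ if and only if all of the following hold: $\mathbf{v}_{\mathbf{x}}$ is a subword of $\mathbf{u}_{\mathbf{x}}$; $\mathbf{u}_{\mathbf{y}}$ is a subword of $\mathbf{v}_{\mathbf{y}}$; and $\mathsf{Inv}(\mathbf{u}_{\mathbf{v}})\subseteq\mathsf{Inv}(\mathbf{v}_{\mathbf{u}})$.
   Context: Disjoint alphabets $X=\{x_1,\dots,x_m\}$, $Y=\{y_1,\dots,y_n\}$; $\mathbf{x}=x_1\cdots x_m$, $\mathbf{y}=y_1\cdots y_n$. A word is simple if it has no repeated letter; a subword of $w_1\cdots w_k$ is $w_{i_1}\cdots w_{i_l}$ with $i_1<\dots<i_l$. For simple words $\mathbf{u},\mathbf{v}$, the restriction $\mathbf{u}_{\mathbf{v}}$ is the subword of $\mathbf{u}$ formed by the letters occurring in both $\mathbf{u}$ and $\mathbf{v}$. $\mathsf{Shuf}(m,n)$ is the set of simple words $\mathbf{u}$ over $X\cup Y$ with $\mathbf{u}_{\mathbf{x}}$ a subword of $\mathbf{x}$ and $\mathbf{u}_{\mathbf{y}}$ a subword of $\mathbf{y}$. For a simple word $\mathbf{w}$, $\mathsf{Inv}(\mathbf{w})=\{(x_s,y_t): y_t\text{ and }x_s\text{ occur in }\mathbf{w}\text{ with }y_t\text{ before }x_s\}$. For $\mathbf{u}=u_1\cdots u_k$, $\mathbf{u}_{\hat\imath}$ is $\mathbf{u}$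 with $u_i$ deleted. Indels: $\mathbf{u}\to\mathbf{u}_{\hat\imath}$ if $u_i\in X$, and $\mathbf{u}_{\hat\imath}\to\mathbf{u}$ if $u_i\in Y$. Transpositions: $\mathbf{u}\Rightarrow\mathbf{u}'$ where $u_i\in X$, $u_{i+1}\in Y$ and $\mathbf{u}'$ is $\mathbf{u}$ with $u_i,u_{i+1}$ swapped. The bubble order $\leq_{\mathsf{bub}}$ on $\mathsf{Shuf}(m,n)$ is the reflexive and transitive closure of indels and transpositions. -}

module Defs where

open import Data.Nat using (ℕ)
open import Data.Fin using (Fin)
import Data.Fin.Properties as FinP
open import Data.Sum using (_⊎_; inj₁; inj₂)
open import Data.Sum.Properties using (≡-dec)
open import Data.Product using (Σ; _×_; ∃; ∃-syntax)
open import Data.List using (List; []; _∷_; _++_; map; filter)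
open import Data.List.Base using (allFin)
open import Data.List.Relation.Unary.Unique.Propositional using (Unique)
open import Data.List.Relation.Binary.Sublist.Propositional using (_⊆_)
open import Relation.Binary.PropositionalEquality using (_≡_)
open import Relation.Binary.Definitions using (DecidableEquality)
open import Relation.Binary.Construct.Closure.ReflexiveTransitive using (Star)

-- Letters over X ∪ Y : inj₁ s is x_{s+1}, inj₂ t is y_{t+1} (0-indexed Fin).
Letter : ℕ → ℕ → Set
Letter m n = Fin m ⊎ Fin n

Word : ℕ → ℕ → Set
Word m n = List (Letter m n)

_≟L_ : ∀ {m n} → DecidableEquality (Letter m n)
_≟L_ = ≡-dec FinP._≟_ FinP._≟_

import Data.List.Membership.DecPropositional as DecMem

𝐱 : (m n : ℕ) → Word m n
𝐱 m n = map inj₁ (allFin m)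

𝐲 : (m n : ℕ) → Word m n
𝐲 m n = map inj₂ (allFin n)

Subword : ∀ {m n} → Word m n → Word m n → Set
Subword u v = u ⊆ v

Simple : ∀ {m n} → Word m n → Set
Simple u = Unique u

-- restriction u_v: subword of u formed by letters occurring in both u and v
restrict : ∀ {m n} → Word m n → Word m n → Word m n
restrict {m} {n} u v = filter (λ a → a ∈? v) u
  where open DecMem (_≟L_ {m} {n}) using (_∈?_)

Shuf : (m n : ℕ) → Word m n → Set
Shuf m n u = Simple u
           × Subword (restrict u (𝐱 m n)) (𝐱 m n)
           × Subword (restrict u (𝐲 m n)) (𝐲 m n)

Inv : ∀ {m n} → Word m n → Fin m → Fin n → Set
Inv w s t = Subword (inj₂ t ∷ inj₁ s ∷ []) w

InvSubset : ∀ {m n} → Word m n → Word m n → Set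
InvSubset {m} {n} w w' = (s : Fin m) (t : Fin n) → Inv w s t → Inv w' s t

data Move {m n : ℕ} : Word m n → Word m n → Set where
  delX  : (p q : Word m n) (a : Fin m) → Move (p ++ inj₁ a ∷ q) (p ++ q)
  insY  : (p q : Word m n) (b : Fin n) → Move (p ++ q) (p ++ inj₂ b ∷ q)
  trans : (p q : Word m n) (a : Fin m) (b : Fin n) →
          Move (p ++ inj₁ a ∷ inj₂ b ∷ q) (p ++ inj₂ b ∷ inj₁ a ∷ q)

ShufMove : (m n : ℕ) → Word m n → Word m n → Set
ShufMove m n u v = Shuf m n u × Shuf m n v × Move u v

BubLeq : (m n : ℕ) → Word m n → Word m n → Set
BubLeq m n u v = Star (ShufMove m n) u v

-- Every move deletes an X-letter, inserts a Y-letter or turns x y into y x,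
-- so along a chain of moves the X-restriction shrinks, the Y-restriction grows
-- and an inversion y_t … x_s survives as long as x_s does; hence the three
-- conditions are necessary.  Conversely, read v from the left.  Its first
-- letter b either does not occur in u (then b is a Y-letter, inserted at the
-- front) or u = p b q where p consists of X-letters only, since a Y-letter in p
-- would have to precede b in v as well.  Deleting p (if b ∈ X) or moving b to
-- the front past p (if b ∈ Y) fixes the first letter, and the conditions pass
-- to the remaining words.  The words along the way lie in Shuf(m,n) because
-- their X-restriction lies inside that of u and their Y-restriction inside
-- that of v.

module Submission where

open import Defs
open import Data.Nat using (ℕ)
open import Data.Fin using (Fin)
open import Data.Sum using (inj₁; inj₂)
open import Data.Product using (_×_; ∃; _,_; proj₁; proj₂)
open import Function.Bundles using (_⇔_; mk⇔)
open import Data.List using (List; []; _∷_; _++_; filter)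
open import Data.List.Properties using (filter-accept; filter-reject; filter-++; filter-none; ++-identityʳ)
open import Data.List.Relation.Unary.All as All using (All; []; _∷_)
open import Data.List.Relation.Unary.All.Properties using (¬Any⇒All¬)
open import Data.List.Relation.Unary.Any using (here; there)
open import Data.List.Relation.Unary.Any.Properties using (¬Any[])
open import Data.List.Relation.Unary.AllPairs using ([]; _∷_)
open import Data.List.Relation.Unary.Unique.Propositional using (Unique)
import Data.List.Relation.Unary.Unique.Propositional.Properties as Unique
open import Data.List.Membership.Propositional using (_∈_; _∉_)
open import Data.List.Membership.Propositional.Properties using (∈-∃++; ∈-insert; ∈-++⁺ˡ; ∈-filter⁺; ∈-filter⁻; ∈-map⁺; ∈-map⁻; ∈-allFin)
open import Data.List.Relation.Binary.Sublist.Propositional using (_⊆_; []; _∷_; _∷ʳ_; ⊆-refl; ⊆-reflexive; ⊆-trans; minimum; from∈; to∈)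
open import Data.List.Relation.Binary.Sublist.Propositional.Properties using (filter⁺; filter-⊆; ∷ˡ⁻; ∷ʳ⁻; ∷⁻; ++⁺; ++⁺ˡ; Any-resp-⊆; All-resp-⊆)
open import Relation.Binary.PropositionalEquality using (_≡_; refl; sym; cong; subst; subst₂; module ≡-Reasoning) renaming (trans to ≡-trans)
open import Relation.Binary.Construct.Closure.ReflexiveTransitive using (Star; ε; _◅_; _◅◅_; gmap; fold)
open import Relation.Nullary using (¬_; yes; no; contradiction)
open import Relation.Unary using (Pred; Decidable; ∁)
import Data.List.Membership.DecPropositional as DecMembership

module _ {a} {A : Set a} where

  Unique-resp-⊆ : ∀ {xs ys : List A} → xs ⊆ ys → Unique ys → Unique xs
  Unique-resp-⊆ []         []       = []
  Unique-resp-⊆ (_ ∷ʳ τ)   (_ ∷ u)  = Unique-resp-⊆ τ u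
  Unique-resp-⊆ (refl ∷ τ) (x≢ ∷ u) = All-resp-⊆ τ x≢ ∷ Unique-resp-⊆ τ u

  Unique-∉-deleted : ∀ p {c : A} {q} → Unique (p ++ c ∷ q) → c ∉ p ++ q
  Unique-∉-deleted []      u                    = Unique.Unique[x∷xs]⇒x∉xs u
  Unique-∉-deleted (_ ∷ p) (e≢ ∷ _) (here refl) = All.lookup e≢ (∈-insert p) refl
  Unique-∉-deleted (_ ∷ p) (_ ∷ u)  (there c∈)  = Unique-∉-deleted p u c∈

  Unique-head-not-later : ∀ {b c : A} {bs} → Unique (b ∷ bs) → ¬ (c ∷ b ∷ [] ⊆ b ∷ bs)
  Unique-head-not-later u τ = Unique.Unique[x∷xs]⇒x∉xs u (to∈ (∷⁻ τ))

  ⊆-insert : ∀ p {c : A} {q} → p ++ q ⊆ p ++ c ∷ q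
  ⊆-insert p {c} = ++⁺ (⊆-refl {x = p}) (c ∷ʳ ⊆-refl)

  ⊆-delete : ∀ {xs} p {c : A} {q} → xs ⊆ p ++ c ∷ q → c ∉ xs → xs ⊆ p ++ q
  ⊆-delete []      (_ ∷ʳ τ)   c∉ = τ
  ⊆-delete []      (refl ∷ τ) c∉ = contradiction (here refl) c∉
  ⊆-delete (e ∷ p) (_ ∷ʳ τ)   c∉ = e ∷ʳ ⊆-delete p τ c∉
  ⊆-delete (e ∷ p) (refl ∷ τ) c∉ = refl ∷ ⊆-delete p τ (λ c∈ → c∉ (there c∈))

  ⊆-swap : ∀ {xs} p {c d : A} {q} → xs ⊆ p ++ c ∷ d ∷ q → ¬ (c ∷ d ∷ [] ⊆ xs) →
           xs ⊆ p ++ d ∷ c ∷ q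
  ⊆-swap []      {c} {d} (_ ∷ʳ (_ ∷ʳ τ))     cd⊈ = d ∷ʳ (c ∷ʳ τ)
  ⊆-swap []      {c} {d} (_ ∷ʳ (refl ∷ τ))   cd⊈ = refl ∷ (c ∷ʳ τ)
  ⊆-swap []      {c} {d} (refl ∷ (_ ∷ʳ τ))   cd⊈ = d ∷ʳ (refl ∷ τ)
  ⊆-swap []      {c} {d} (refl ∷ (refl ∷ τ)) cd⊈ = contradiction (refl ∷ (refl ∷ minimum _)) cd⊈
  ⊆-swap (e ∷ p) (_ ∷ʳ τ)   cd⊈ = e ∷ʳ ⊆-swap p τ cd⊈
  ⊆-swap (e ∷ p) (refl ∷ τ) cd⊈ = refl ∷ ⊆-swap p τ (λ σ → cd⊈ (e ∷ʳ σ))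

  ⊆-cancel : ∀ {a : A} {xs} ys {zs} → a ∷ xs ⊆ ys ++ a ∷ zs → a ∉ ys → xs ⊆ zs
  ⊆-cancel []       (_ ∷ʳ τ)   a∉ = ∷ˡ⁻ τ
  ⊆-cancel []       (refl ∷ τ) a∉ = τ
  ⊆-cancel (_ ∷ ys) (_ ∷ʳ τ)   a∉ = ⊆-cancel ys τ (λ a∈ → a∉ (there a∈))
  ⊆-cancel (_ ∷ ys) (refl ∷ τ) a∉ = contradiction (here refl) a∉

  ⊆-suffix : ∀ p {c : A} {q} → q ⊆ p ++ c ∷ q
  ⊆-suffix p {c} = ++⁺ˡ p (c ∷ʳ ⊆-refl)

  ∈⇒pair⊆ : ∀ {c d : A} {p q} → c ∈ p → c ∷ d ∷ [] ⊆ p ++ d ∷ q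
  ∈⇒pair⊆ c∈p = ++⁺ (from∈ c∈p) (from∈ (here refl))

module _ {a p} {A : Set a} {P : Pred A p} (P? : Decidable P) where

  filter-delete : ∀ p {c q} → ¬ P c → filter P? (p ++ c ∷ q) ≡ filter P? (p ++ q)
  filter-delete p {c} {q} ¬Pc = begin
    filter P? (p ++ c ∷ q)           ≡⟨ filter-++ P? p (c ∷ q) ⟩
    filter P? p ++ filter P? (c ∷ q) ≡⟨ cong (filter P? p ++_) (filter-reject P? ¬Pc) ⟩
    filter P? p ++ filter P? q       ≡⟨ filter-++ P? p q ⟨
    filter P? (p ++ q)               ∎
    where open ≡-Reasoning

  filter-swap : ∀ p {c d q} → ¬ P d → filter P? (p ++ c ∷ d ∷ q) ≡ filter P? (p ++ d ∷ c ∷ q)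
  filter-swap p {c} {d} {q} ¬Pd = begin
    filter P? (p ++ c ∷ d ∷ q)           ≡⟨ filter-++ P? p (c ∷ d ∷ q) ⟩
    filter P? p ++ filter P? (c ∷ d ∷ q) ≡⟨ cong (filter P? p ++_) swap-head ⟩
    filter P? p ++ filter P? (d ∷ c ∷ q) ≡⟨ filter-++ P? p (d ∷ c ∷ q) ⟨
    filter P? (p ++ d ∷ c ∷ q)           ∎
    where
    open ≡-Reasoning
    swap-head : filter P? (c ∷ d ∷ q) ≡ filter P? (d ∷ c ∷ q)
    swap-head = ≡-trans (filter-delete (c ∷ []) ¬Pd) (sym (filter-reject P? ¬Pd))

  filter-none-++ : ∀ {p} q → All (∁ P) p → filter P? (p ++ q) ≡ filter P? q
  filter-none-++ {p} q ¬Pp = begin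
    filter P? (p ++ q)         ≡⟨ filter-++ P? p q ⟩
    filter P? p ++ filter P? q ≡⟨ cong (_++ filter P? q) (filter-none P? ¬Pp) ⟩
    filter P? q                ∎
    where open ≡-Reasoning

  filter-mono : ∀ {xs ys} → xs ⊆ ys → filter P? xs ⊆ filter P? ys
  filter-mono = filter⁺ P? P? (λ { refl Pc → Pc })

  filter-pair⁺ : ∀ {a b xs} → a ∷ b ∷ [] ⊆ xs → P a → P b → a ∷ b ∷ [] ⊆ filter P? xs
  filter-pair⁺ {a} τ Pa Pb =
    subst (_⊆ _) (≡-trans (filter-accept P? Pa) (cong (a ∷_) (filter-accept P? Pb))) (filter-mono τ)

module _ {m n : ℕ} where

  open DecMembership (_≟L_ {m} {n}) using (_∈?_)

  private
    W : Set
    W = Word m n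

  X? : Decidable (_∈ 𝐱 m n)
  X? c = c ∈? 𝐱 m n

  Y? : Decidable (_∈ 𝐲 m n)
  Y? c = c ∈? 𝐲 m n

  _↾X _↾Y : W → W
  u ↾X = restrict u (𝐱 m n)
  u ↾Y = restrict u (𝐲 m n)

  x∈𝐱 : ∀ s → inj₁ s ∈ 𝐱 m n
  x∈𝐱 s = ∈-map⁺ inj₁ (∈-allFin s)

  y∈𝐲 : ∀ t → inj₂ t ∈ 𝐲 m n
  y∈𝐲 t = ∈-map⁺ inj₂ (∈-allFin t)

  y∉𝐱 : ∀ t → inj₂ t ∉ 𝐱 m n
  y∉𝐱 t y∈ with ∈-map⁻ inj₁ y∈
  ... | _ , _ , ()

  x∉𝐲 : ∀ s → inj₁ s ∉ 𝐲 m n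
  x∉𝐲 s x∈ with ∈-map⁻ inj₂ x∈
  ... | _ , _ , ()

  Unique-from-↾ : ∀ w → Unique (w ↾X) → Unique (w ↾Y) → Unique w
  Unique-from-↾ []           _  _  = []
  Unique-from-↾ (inj₁ s ∷ w) ux uy with subst Unique (filter-accept X? (x∈𝐱 s)) ux
  ... | s∉ ∷ ux′ = ¬Any⇒All¬ w (λ s∈w → All.lookup s∉ (∈-filter⁺ X? s∈w (x∈𝐱 s)) refl)
                   ∷ Unique-from-↾ w ux′ (subst Unique (filter-reject Y? (x∉𝐲 s)) uy)
  Unique-from-↾ (inj₂ t ∷ w) ux uy with subst Unique (filter-accept Y? (y∈𝐲 t)) uy
  ... | t∉ ∷ uy′ = ¬Any⇒All¬ w (λ t∈w → All.lookup t∉ (∈-filter⁺ Y? t∈w (y∈𝐲 t)) refl)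
                   ∷ Unique-from-↾ w (subst Unique (filter-reject X? (y∉𝐱 t)) ux) uy′

  Shuf-between : ∀ {u v w} → Shuf m n u → Shuf m n v → w ↾X ⊆ u ↾X → w ↾Y ⊆ v ↾Y → Shuf m n w
  Shuf-between {w = w} (uu , uX , _) (uv , _ , vY) wX wY =
    Unique-from-↾ w (Unique-resp-⊆ wX (Unique.filter⁺ X? uu)) (Unique-resp-⊆ wY (Unique.filter⁺ Y? uv)) ,
    ⊆-trans wX uX ,
    ⊆-trans wY vY

  Move⇒↾X⊇ : ∀ {u w : W} → Move u w → w ↾X ⊆ u ↾X
  Move⇒↾X⊇ (delX p q a)    = filter-mono X? (⊆-insert p)
  Move⇒↾X⊇ (insY p q b)    = ⊆-reflexive (filter-delete X? p (y∉𝐱 b))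
  Move⇒↾X⊇ (trans p q a b) = ⊆-reflexive (sym (filter-swap X? p (y∉𝐱 b)))

  Move⇒↾Y⊆ : ∀ {u w : W} → Move u w → u ↾Y ⊆ w ↾Y
  Move⇒↾Y⊆ (delX p q a)    = ⊆-reflexive (filter-delete Y? p (x∉𝐲 a))
  Move⇒↾Y⊆ (insY p q b)    = filter-mono Y? (⊆-insert p)
  Move⇒↾Y⊆ (trans p q a b) = ⊆-reflexive (sym (filter-swap Y? p (x∉𝐲 a)))

  Moves : W → W → Set
  Moves = Star Move

  Moves⇒↾Y⊆ : ∀ {u w} → Moves u w → u ↾Y ⊆ w ↾Y
  Moves⇒↾Y⊆ = fold (λ u w → u ↾Y ⊆ w ↾Y) (λ mv τ → ⊆-trans (Move⇒↾Y⊆ mv) τ) ⊆-refl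

  xy⊈yx : ∀ {a s : Fin m} {b t : Fin n} → ¬ (inj₁ a ∷ inj₂ b ∷ [] ⊆ inj₂ t ∷ inj₁ s ∷ [])
  xy⊈yx (() ∷ _)
  xy⊈yx (_ ∷ʳ (refl ∷ ()))
  xy⊈yx (_ ∷ʳ (_ ∷ʳ ()))

  Move-keeps-Inv : ∀ {u w : W} {s t} → Unique u → Move u w → Inv u s t → inj₁ s ∈ w → Inv w s t
  Move-keeps-Inv uu (delX p q a) inv s∈w = ⊆-delete p inv λ
    { (here ()) ; (there (here refl)) → Unique-∉-deleted p uu s∈w ; (there (there ())) }
  Move-keeps-Inv uu (insY p q b)    inv _ = ⊆-trans inv (⊆-insert p)
  Move-keeps-Inv uu (trans p q a b) inv _ = ⊆-swap p inv xy⊈yx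

  InvKept : W → W → Set
  InvKept u v = ∀ s t → Inv u s t → inj₁ s ∈ v → inj₂ t ∈ v → Inv v s t

  InvSubset⇒InvKept : ∀ {u v} → InvSubset (restrict u v) (restrict v u) → InvKept u v
  InvSubset⇒InvKept {u} {v} h s t inv s∈v t∈v =
    ⊆-trans (h s t (filter-pair⁺ (_∈? v) inv t∈v s∈v)) (filter-⊆ (_∈? u) v)

  InvKept⇒InvSubset : ∀ {u v} → InvKept u v → InvSubset (restrict u v) (restrict v u)
  InvKept⇒InvSubset {u} {v} kept s t inv =
    filter-pair⁺ (_∈? u) (kept s t inv-u s∈v t∈v) (to∈ inv-u) (to∈ (∷ˡ⁻ inv-u))
    where
    inv-u : Inv u s t
    inv-u = ⊆-trans inv (filter-⊆ (_∈? v) u)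
    s∈v : inj₁ s ∈ v
    s∈v = proj₂ (∈-filter⁻ (_∈? v) {xs = u} (to∈ (∷ˡ⁻ inv)))
    t∈v : inj₂ t ∈ v
    t∈v = proj₂ (∈-filter⁻ (_∈? v) {xs = u} (to∈ inv))

  record Criterion (u v : W) : Set where
    field
      X-shrinks : v ↾X ⊆ u ↾X
      Y-grows   : u ↾Y ⊆ v ↾Y
      Inv-kept  : InvKept u v

  open Criterion public

  Criterion⇒x∈ : ∀ {u v s} → Criterion u v → inj₁ s ∈ v → inj₁ s ∈ u
  Criterion⇒x∈ {u} c s∈v =
    Any-resp-⊆ (filter-⊆ X? u) (Any-resp-⊆ (X-shrinks c) (∈-filter⁺ X? s∈v (x∈𝐱 _)))

  Criterion⇒y∈ : ∀ {u v t} → Criterion u v → inj₂ t ∈ u → inj₂ t ∈ v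
  Criterion⇒y∈ {v = v} c t∈u =
    Any-resp-⊆ (filter-⊆ Y? v) (Any-resp-⊆ (Y-grows c) (∈-filter⁺ Y? t∈u (y∈𝐲 _)))

  Criterion-refl : ∀ {u} → Criterion u u
  Criterion-refl = record { X-shrinks = ⊆-refl ; Y-grows = ⊆-refl ; Inv-kept = λ _ _ inv _ _ → inv }

  Criterion-step : ∀ {u w v} → Unique u → Move u w → Criterion w v → Criterion u v
  Criterion-step uu mv c = record
    { X-shrinks = ⊆-trans (X-shrinks c) (Move⇒↾X⊇ mv)
    ; Y-grows   = ⊆-trans (Move⇒↾Y⊆ mv) (Y-grows c)
    ; Inv-kept  = λ s t inv s∈v t∈v →
        Inv-kept c s t (Move-keeps-Inv uu mv inv (Criterion⇒x∈ c s∈v)) s∈v t∈v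
    }

  ≤⇒Criterion : ∀ {u v} → BubLeq m n u v → Criterion u v
  ≤⇒Criterion = fold Criterion (λ (su , _ , mv) → Criterion-step (proj₁ su) mv) Criterion-refl

  IsX : Letter m n → Set
  IsX c = ∃ λ s → c ≡ inj₁ s

  ¬y⇒All-IsX : ∀ p → (∀ t → inj₂ t ∉ p) → All IsX p
  ¬y⇒All-IsX []           _  = []
  ¬y⇒All-IsX (inj₁ s ∷ p) ¬y = (s , refl) ∷ ¬y⇒All-IsX p (λ t t∈p → ¬y t (there t∈p))
  ¬y⇒All-IsX (inj₂ t ∷ p) ¬y = contradiction (here refl) (¬y t)

  All-IsX⇒↾Y-++ : ∀ {p} r → All IsX p → (p ++ r) ↾Y ≡ r ↾Y
  All-IsX⇒↾Y-++ r xs = filter-none-++ Y? r (All.map (λ { (s , refl) → x∉𝐲 s }) xs)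

  Move-cons : ∀ c {u w : W} → Move u w → Move (c ∷ u) (c ∷ w)
  Move-cons c (delX p q a)    = delX (c ∷ p) q a
  Move-cons c (insY p q b)    = insY (c ∷ p) q b
  Move-cons c (trans p q a b) = trans (c ∷ p) q a b

  Moves-cons : ∀ c {u w : W} → Moves u w → Moves (c ∷ u) (c ∷ w)
  Moves-cons c = gmap (c ∷_) (Move-cons c)

  delete-Xs : ∀ {p r : W} → All IsX p → Moves (p ++ r) r
  delete-Xs                []                = ε
  delete-Xs {_ ∷ p} {r} ((s , refl) ∷ xs) = delX [] (p ++ r) s ◅ delete-Xs xs

  bubble-Y : ∀ {p q : W} {t} → All IsX p → Moves (p ++ inj₂ t ∷ q) (inj₂ t ∷ p ++ q)
  bubble-Y                 []                = ε
  bubble-Y {_ ∷ p} {q} {t} ((s , refl) ∷ xs) =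
    Moves-cons (inj₁ s) (bubble-Y xs) ◅◅ trans [] (p ++ q) s t ◅ ε

  prefix-All-IsX : ∀ {p q} b {v} → Unique (b ∷ v) → Criterion (p ++ b ∷ q) (b ∷ v) → All IsX p
  prefix-All-IsX {p} (inj₁ s) uv c = ¬y⇒All-IsX p λ t t∈p → Unique-head-not-later uv
    (Inv-kept c s t (∈⇒pair⊆ t∈p) (here refl) (Criterion⇒y∈ c (∈-++⁺ˡ t∈p)))
  prefix-All-IsX {p} (inj₂ t′) uv c = ¬y⇒All-IsX p λ t t∈p → Unique-head-not-later uv
    (⊆-trans (filter-pair⁺ Y? (∈⇒pair⊆ t∈p) (y∈𝐲 t) (y∈𝐲 t′)) (⊆-trans (Y-grows c) (filter-⊆ Y? _)))

  Criterion-after-insert : ∀ {u v t} → inj₂ t ∉ u → Criterion u (inj₂ t ∷ v) → Criterion u v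
  Criterion-after-insert {u} {v} {t} t∉u c = record
    { X-shrinks = subst (_⊆ u ↾X) (filter-reject X? (y∉𝐱 t)) (X-shrinks c)
    ; Y-grows   = ⊆-delete [] (subst (u ↾Y ⊆_) (filter-accept Y? (y∈𝐲 t)) (Y-grows c))
                    (λ t∈ → t∉u (Any-resp-⊆ (filter-⊆ Y? u) t∈))
    ; Inv-kept  = λ s′ t′ inv s∈ t∈ →
        ⊆-delete [] (Inv-kept c s′ t′ inv (there s∈) (there t∈)) λ
        { (here refl) → t∉u (to∈ inv) ; (there (here ())) ; (there (there ())) }
    }

  Criterion-after-delete : ∀ {p q v s} → Unique (p ++ inj₁ s ∷ q) →
                           Criterion (p ++ inj₁ s ∷ q) (inj₁ s ∷ v) → Criterion q v
  Criterion-after-delete {p} {q} {v} {s} uu c = record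
    { X-shrinks = ⊆-cancel (p ↾X) (subst₂ _⊆_ (filter-accept X? (x∈𝐱 s)) ↾X-split (X-shrinks c))
                    (λ s∈ → Unique-∉-deleted p uu (∈-++⁺ˡ (Any-resp-⊆ (filter-⊆ X? p) s∈)))
    ; Y-grows   = ⊆-trans (filter-mono Y? (⊆-suffix p))
                    (subst (_ ⊆_) (filter-reject Y? (x∉𝐲 s)) (Y-grows c))
    ; Inv-kept  = λ s′ t′ inv s∈ t∈ →
        ∷ʳ⁻ (λ ()) (Inv-kept c s′ t′ (⊆-trans inv (⊆-suffix p)) (there s∈) (there t∈))
    }
    where
    ↾X-split : (p ++ inj₁ s ∷ q) ↾X ≡ p ↾X ++ inj₁ s ∷ q ↾X
    ↾X-split = ≡-trans (filter-++ X? p (inj₁ s ∷ q)) (cong (p ↾X ++_) (filter-accept X? (x∈𝐱 s)))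

  Criterion-after-bubble : ∀ {p q v t} → Unique (inj₂ t ∷ v) → All IsX p →
                           Criterion (p ++ inj₂ t ∷ q) (inj₂ t ∷ v) → Criterion (p ++ q) v
  Criterion-after-bubble {p} {q} {v} {t} uv xs c = record
    { X-shrinks = subst₂ _⊆_ (filter-reject X? (y∉𝐱 t)) (filter-delete X? p (y∉𝐱 t)) (X-shrinks c)
    ; Y-grows   = subst (_⊆ v ↾Y) (sym (All-IsX⇒↾Y-++ q xs))
                    (∷⁻ (subst₂ _⊆_ ↾Y-head (filter-accept Y? (y∈𝐲 t)) (Y-grows c)))
    ; Inv-kept  = λ s′ t′ inv s∈ t∈ →
        ⊆-delete [] (Inv-kept c s′ t′ (⊆-trans inv (⊆-insert p)) (there s∈) (there t∈)) λ
        { (here refl) → Unique.Unique[x∷xs]⇒x∉xs uv t∈ ; (there (here ())) ; (there (there ())) }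
    }
    where
    ↾Y-head : (p ++ inj₂ t ∷ q) ↾Y ≡ inj₂ t ∷ q ↾Y
    ↾Y-head = ≡-trans (All-IsX⇒↾Y-++ (inj₂ t ∷ q) xs) (filter-accept Y? (y∈𝐲 t))

  Criterion⇒Moves : ∀ v {u} → Unique u → Unique v → Criterion u v → Moves u v
  Criterion⇒Moves [] {u} _ _ c =
    subst (λ w → Moves w []) (++-identityʳ u)
      (delete-Xs (¬y⇒All-IsX u (λ t t∈u → ¬Any[] (Criterion⇒y∈ c t∈u))))
  Criterion⇒Moves (inj₁ s ∷ v) uu uv@(_ ∷ uv′) c with ∈-∃++ (Criterion⇒x∈ c (here refl))
  ... | p , q , refl =
    delete-Xs (prefix-All-IsX (inj₁ s) uv c)
      ◅◅ Moves-cons (inj₁ s) (Criterion⇒Moves v (Unique-resp-⊆ (⊆-suffix p) uu) uv′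
                               (Criterion-after-delete uu c))
  Criterion⇒Moves (inj₂ t ∷ v) {u} uu uv@(_ ∷ uv′) c with inj₂ t ∈? u
  ... | no t∉u =
    insY [] u t ◅ Moves-cons (inj₂ t) (Criterion⇒Moves v uu uv′ (Criterion-after-insert t∉u c))
  ... | yes t∈u with ∈-∃++ t∈u
  ... | p , q , refl =
    bubble-Y xs ◅◅ Moves-cons (inj₂ t) (Criterion⇒Moves v (Unique-resp-⊆ (⊆-insert p) uu) uv′
                                         (Criterion-after-bubble uv xs c))
    where
    xs : All IsX p
    xs = prefix-All-IsX (inj₂ t) uv c

  Moves⇒≤ : ∀ {u v} → Shuf m n u → Shuf m n v → Moves u v → BubLeq m n u v
  Moves⇒≤ su sv ε = ε
  Moves⇒≤ su sv (_◅_ {j = w} mv mvs) = (su , sw , mv) ◅ Moves⇒≤ sw sv mvs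
    where
    sw : Shuf m n w
    sw = Shuf-between su sv (Move⇒↾X⊇ mv) (Moves⇒↾Y⊆ mvs)

lemma3p1 : (m n : ℕ) (u v : Word m n) → Shuf m n u → Shuf m n v →
    (BubLeq m n u v ⇔
      (Subword (restrict v (𝐱 m n)) (restrict u (𝐱 m n))
       × Subword (restrict u (𝐲 m n)) (restrict v (𝐲 m n))
       × InvSubset (restrict u v) (restrict v u)))
lemma3p1 m n u v su@(uu , _) sv@(uv , _) = mk⇔
  (λ u≤v → let c = ≤⇒Criterion u≤v in
    X-shrinks c , Y-grows c , InvKept⇒InvSubset (Inv-kept c))
  (λ (vX⊆uX , uY⊆vY , inv) → Moves⇒≤ su sv (Criterion⇒Moves v uu uv record
    { X-shrinks = vX⊆uX ; Y-grows = uY⊆vY ; Inv-kept = InvSubset⇒InvKept inv }))
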